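{- Let $A\in\mathbb{R}^{m\times n}$ and let $A'\in\overline{\mathbb{R}}^{(m+1)\times(n+1)}$ be defined by $A'_{ij}=A_{ij}$ and $A'_{i,n+1}=A'_{m+1,j}=\infty$ for $i\leq m$, $j\leq n$, and $A'_{m+1,n+1}=0$. Then the factor rank of $A$ is one less than the factor rank of $A'$.
   Context: $\overline{\mathbb{R}}=\mathbb{R}\cup\{\infty\}$ with operations $a\oplus b=\min\{a,b\}$, $a\otimes b=a+b$, where $a\oplus\infty=a$ and $a\otimes\infty=\infty$; $(B\otimes C)_{ij}=\min_{\tau}\{B_{i\tau}+C_{\tau j}\}$. The factor rank of $A\in\overline{\mathbb{R}}^{m\times n}$ is the smallest $k$ for which there exist $B\in\overline{\mathbb{R}}^{m\times k}$, $C\in\overline{\mathbb{R}}^{k\times n}$ with $A=B\otimes C$ (for real matrices this agrees with the definition using real $B,C$). -}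

module Defs where

open import Level using (0ℓ)
open import Data.Nat as ℕ using (ℕ; zero; suc)
open import Data.Fin using (Fin; zero; suc)
open import Data.Product using (Σ; ∃; _×_; _,_)
open import Data.Sum using (_⊎_; inj₁; inj₂)
open import Data.Maybe as Maybe using (Maybe; just; nothing)
open import Relation.Binary.PropositionalEquality using (_≡_)
open import Relation.Binary.Core using (Rel)
open import Relation.Binary.Structures using (IsTotalOrder)
open import Relation.Nullary using (¬_)
open import Algebra.Structures using (IsCommutativeRing)

-- The real numbers, axiomatised as a (Dedekind-)complete ordered field.
-- Any two such structures are isomorphic, so quantifying over all
-- models of this record is the same as speaking about ℝ.

record RealField : Set₁ where
  field
    Carrier : Set
    _+_ _*_ : Carrier → Carrier → Carrier
    -_      : Carrier → Carrier
    0# 1#   : Carrier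
    _≤_     : Rel Carrier 0ℓ
    isCommutativeRing : IsCommutativeRing _≡_ _+_ _*_ -_ 0# 1#
    0≢1     : ¬ (0# ≡ 1#)
    inverse : ∀ x → ¬ (x ≡ 0#) → Σ Carrier (λ y → x * y ≡ 1#)
    isTotalOrder : IsTotalOrder _≡_ _≤_
    +-mono  : ∀ x y z → x ≤ y → (x + z) ≤ (y + z)
    *-pos   : ∀ x y → 0# ≤ x → 0# ≤ y → 0# ≤ (x * y)
    complete : (P : Carrier → Set) → Σ Carrier P →
               Σ Carrier (λ b → ∀ x → P x → x ≤ b) →
               Σ Carrier (λ s → (∀ x → P x → x ≤ s) ×
                                (∀ b → (∀ x → P x → x ≤ b) → s ≤ b))

module Tropical (ℝ : RealField) where
  open RealField ℝ
  open IsTotalOrder isTotalOrder using (total)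

  data ℝ̄ : Set where
    fin : Carrier → ℝ̄
    ∞   : ℝ̄

  _⊕_ : ℝ̄ → ℝ̄ → ℝ̄
  ∞ ⊕ b = b
  fin a ⊕ ∞ = fin a
  fin a ⊕ fin b with total a b
  ... | inj₁ _ = fin a
  ... | inj₂ _ = fin b

  _⊗_ : ℝ̄ → ℝ̄ → ℝ̄
  ∞ ⊗ b = ∞
  fin a ⊗ ∞ = ∞
  fin a ⊗ fin b = fin (a + b)

  ⨁ : (k : ℕ) → (Fin k → ℝ̄) → ℝ̄
  ⨁ zero f = ∞
  ⨁ (suc k) f = f zero ⊕ ⨁ k (λ τ → f (suc τ))

  Matrix : ℕ → ℕ → Set
  Matrix m n = Fin m → Fin n → ℝ̄

  _⊗ᴹ_ : ∀ {m k n} → Matrix m k → Matrix k n → Matrix m n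
  _⊗ᴹ_ {k = k} B C i j = ⨁ k (λ τ → B i τ ⊗ C τ j)

  FactorsThrough : ∀ {m n} → Matrix m n → ℕ → Set
  FactorsThrough {m} {n} A k =
    Σ (Matrix m k) λ B → Σ (Matrix k n) λ C →
      ∀ i j → A i j ≡ (B ⊗ᴹ C) i j

  IsFactorRank : ∀ {m n} → Matrix m n → ℕ → Set
  IsFactorRank A r = FactorsThrough A r × (∀ k → FactorsThrough A k → r ℕ.≤ k)

  embed : ∀ {m n} → (Fin m → Fin n → Carrier) → Matrix m n
  embed A i j = fin (A i j)

  -- Decode an index of Fin (m+1): `just i` for i ≤ m (i.e. inject₁ i),
  -- `nothing` for the last index m+1 (i.e. fromℕ m).
  split-last : ∀ {m} → Fin (suc m) → Maybe (Fin m)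
  split-last {zero}  zero    = nothing
  split-last {suc m} zero    = just zero
  split-last {suc m} (suc i) = Maybe.map suc (split-last i)

  extend : ∀ {m n} → (Fin m → Fin n → Carrier) → Matrix (suc m) (suc n)
  extend A i j with split-last i | split-last j
  ... | just i′  | just j′  = fin (A i′ j′)
  ... | just _   | nothing  = ∞
  ... | nothing  | just _   = ∞
  ... | nothing  | nothing  = fin 0#

-- A factorisation of A
-- through k inner indices extends to one of A′ through k + 1 by adjoining an
-- inner index that carries only the corner 0.  Conversely, in A′ = B′ ⊗ C′
-- the corner 0 is attained at some inner index τ₀, where C′ τ₀ (n+1) is finite;
-- as the rest of the last column of A′ is ∞, column τ₀ of B′ is ∞ on the first
-- m rows, so τ₀ contributes nothing to the A-block and can be dropped.
module Submission where

open import Defs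
open import Data.Nat using (ℕ; zero; suc; s≤s; ≤-pred)
open import Data.Fin using (Fin; zero; suc; fromℕ; inject₁; punchIn)
open import Data.Product using (_×_; _,_; ∃; proj₁; proj₂)
open import Data.Sum using (inj₁; inj₂)
open import Data.Maybe using (Maybe; just; nothing)
open import Function using (_∘_)
open import Relation.Nullary using (¬_; contradiction)
open import Relation.Binary.PropositionalEquality
open import Relation.Binary.Structures using (IsTotalOrder)
open import Algebra.Structures using (IsCommutativeRing)
open import Algebra.Definitions using (Selective)

module TropicalFactorRank (ℝ : RealField) where
  open RealField ℝ
  open Tropical ℝ
  open IsCommutativeRing isCommutativeRing using (+-identityʳ)
  open IsTotalOrder isTotalOrder using (total)

  ⊕-sel : Selective _≡_ _⊕_
  ⊕-sel ∞       y       = inj₂ refl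
  ⊕-sel (fin a) ∞       = inj₁ refl
  ⊕-sel (fin a) (fin b) with total a b
  ... | inj₁ _ = inj₁ refl
  ... | inj₂ _ = inj₂ refl

  ⊕≡∞⇒ : ∀ x y → x ⊕ y ≡ ∞ → x ≡ ∞ × y ≡ ∞
  ⊕≡∞⇒ ∞       y       x⊕y≡∞ = refl , x⊕y≡∞
  ⊕≡∞⇒ (fin a) (fin b) x⊕y≡∞ with ⊕-sel (fin a) (fin b)
  ... | inj₁ x⊕y≡x = contradiction (trans (sym x⊕y≡x) x⊕y≡∞) λ ()
  ... | inj₂ x⊕y≡y = contradiction (trans (sym x⊕y≡y) x⊕y≡∞) λ ()

  ⊗-zeroʳ : ∀ x → x ⊗ ∞ ≡ ∞
  ⊗-zeroʳ (fin a) = refl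
  ⊗-zeroʳ ∞       = refl

  ⊗≡∞⇒ˡ : ∀ x {y} → ¬ y ≡ ∞ → x ⊗ y ≡ ∞ → x ≡ ∞
  ⊗≡∞⇒ˡ ∞       y≢∞ _ = refl
  ⊗≡∞⇒ˡ (fin a) {∞} y≢∞ _ = contradiction refl y≢∞

  ⊗≢∞⇒ʳ : ∀ x y → ¬ x ⊗ y ≡ ∞ → ¬ y ≡ ∞
  ⊗≢∞⇒ʳ x .∞ x⊗y≢∞ refl = x⊗y≢∞ (⊗-zeroʳ x)

  ⨁-∞ : ∀ k (f : Fin k → ℝ̄) → (∀ τ → f τ ≡ ∞) → ⨁ k f ≡ ∞
  ⨁-∞ zero    f f≡∞ = refl
  ⨁-∞ (suc k) f f≡∞ rewrite f≡∞ zero = ⨁-∞ k (f ∘ suc) (f≡∞ ∘ suc)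

  ⨁≡∞⇒ : ∀ k (f : Fin k → ℝ̄) → ⨁ k f ≡ ∞ → ∀ τ → f τ ≡ ∞
  ⨁≡∞⇒ (suc k) f ⨁≡∞ zero    = let f₀≡∞ , _ = ⊕≡∞⇒ (f zero) _ ⨁≡∞ in f₀≡∞
  ⨁≡∞⇒ (suc k) f ⨁≡∞ (suc τ) = let _ , rest≡∞ = ⊕≡∞⇒ (f zero) _ ⨁≡∞ in ⨁≡∞⇒ k (f ∘ suc) rest≡∞ τ

  ⨁≡fin⇒ : ∀ k (f : Fin k → ℝ̄) {c} → ⨁ k f ≡ fin c → ∃ λ τ → f τ ≡ fin c
  ⨁≡fin⇒ (suc k) f ⨁≡c with ⊕-sel (f zero) (⨁ k (f ∘ suc))
  ... | inj₁ ⨁≡f₀   = zero , trans (sym ⨁≡f₀) ⨁≡c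
  ... | inj₂ ⨁≡rest with ⨁≡fin⇒ k (f ∘ suc) (trans (sym ⨁≡rest) ⨁≡c)
  ...   | τ , fτ≡c = suc τ , fτ≡c

  ⨁-drop-∞ : ∀ k (f : Fin (suc k) → ℝ̄) τ₀ → f τ₀ ≡ ∞ → ⨁ (suc k) f ≡ ⨁ k (f ∘ punchIn τ₀)
  ⨁-drop-∞ k       f zero     fτ₀≡∞ rewrite fτ₀≡∞ = refl
  ⨁-drop-∞ (suc k) f (suc τ₀) fτ₀≡∞ = cong (f zero ⊕_) (⨁-drop-∞ k (f ∘ suc) τ₀ fτ₀≡∞)

  split-last-fromℕ : ∀ m → split-last (fromℕ m) ≡ nothing
  split-last-fromℕ zero    = refl
  split-last-fromℕ (suc m) rewrite split-last-fromℕ m = refl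

  split-last-inject₁ : ∀ {m} (i : Fin m) → split-last (inject₁ i) ≡ just i
  split-last-inject₁ {suc m} zero    = refl
  split-last-inject₁ {suc m} (suc i) rewrite split-last-inject₁ i = refl

  module _ {m n : ℕ} (A : Fin m → Fin n → Carrier) where

    extend-inject₁-inject₁ : ∀ i j → extend A (inject₁ i) (inject₁ j) ≡ fin (A i j)
    extend-inject₁-inject₁ i j rewrite split-last-inject₁ i | split-last-inject₁ j = refl

    extend-inject₁-fromℕ : ∀ i → extend A (inject₁ i) (fromℕ n) ≡ ∞
    extend-inject₁-fromℕ i rewrite split-last-inject₁ i | split-last-fromℕ n = refl

    extend-fromℕ-fromℕ : extend A (fromℕ m) (fromℕ n) ≡ fin 0#
    extend-fromℕ-fromℕ rewrite split-last-fromℕ m | split-last-fromℕ n = refl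

    adjoinRow : ∀ {k} → Matrix m k → Maybe (Fin m) → Fin (suc k) → ℝ̄
    adjoinRow B (just i) zero    = ∞
    adjoinRow B nothing  zero    = fin 0#
    adjoinRow B (just i) (suc τ) = B i τ
    adjoinRow B nothing  (suc τ) = ∞

    adjoinColumn : ∀ {k} → Matrix k n → Fin (suc k) → Maybe (Fin n) → ℝ̄
    adjoinColumn C zero    (just j) = ∞
    adjoinColumn C zero    nothing  = fin 0#
    adjoinColumn C (suc τ) (just j) = C τ j
    adjoinColumn C (suc τ) nothing  = ∞

    extend-factorsThrough : ∀ {k} → FactorsThrough (embed A) k → FactorsThrough (extend A) (suc k)
    extend-factorsThrough {k} (B , C , A≡BC) = B′ , C′ , A′≡B′C′
      where
      B′ : Matrix (suc m) (suc k)
      B′ i = adjoinRow B (split-last i)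

      C′ : Matrix (suc k) (suc n)
      C′ τ j = adjoinColumn C τ (split-last j)

      A′≡B′C′ : ∀ i j → extend A i j ≡ (B′ ⊗ᴹ C′) i j
      A′≡B′C′ i j with split-last i | split-last j
      ... | just i′ | just j′ = A≡BC i′ j′
      ... | just i′ | nothing = sym (⨁-∞ k _ (λ τ → ⊗-zeroʳ (B i′ τ)))
      ... | nothing | just j′ = sym (⨁-∞ k _ (λ τ → refl))
      ... | nothing | nothing
        rewrite ⨁-∞ k (λ τ → adjoinRow B nothing (suc τ) ⊗ adjoinColumn C (suc τ) nothing) (λ τ → refl)
        = cong fin (sym (+-identityʳ 0#))

    ¬extend-factorsThrough-0 : ¬ FactorsThrough (extend A) 0
    ¬extend-factorsThrough-0 (B′ , C′ , A′≡B′C′)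
      with () ← trans (sym extend-fromℕ-fromℕ) (A′≡B′C′ (fromℕ m) (fromℕ n))

    embed-factorsThrough : ∀ {k} → FactorsThrough (extend A) (suc k) → FactorsThrough (embed A) k
    embed-factorsThrough {k} (B′ , C′ , A′≡B′C′) = B , C , A≡BC
      where
      term : Fin (suc m) → Fin (suc n) → Fin (suc k) → ℝ̄
      term i j τ = B′ i τ ⊗ C′ τ j

      corner : ∃ λ τ → term (fromℕ m) (fromℕ n) τ ≡ fin 0#
      corner = ⨁≡fin⇒ (suc k) (term (fromℕ m) (fromℕ n))
                 (trans (sym (A′≡B′C′ (fromℕ m) (fromℕ n))) extend-fromℕ-fromℕ)

      τ₀ : Fin (suc k)
      τ₀ = proj₁ corner

      C′τ₀-last≢∞ : ¬ C′ τ₀ (fromℕ n) ≡ ∞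
      C′τ₀-last≢∞ = ⊗≢∞⇒ʳ (B′ (fromℕ m) τ₀) _ (λ term≡∞ → contradiction (trans (sym (proj₂ corner)) term≡∞) λ ())

      B′-τ₀≡∞ : ∀ i → B′ (inject₁ i) τ₀ ≡ ∞
      B′-τ₀≡∞ i = ⊗≡∞⇒ˡ (B′ (inject₁ i) τ₀) C′τ₀-last≢∞ (⨁≡∞⇒ (suc k) (term (inject₁ i) (fromℕ n)) column≡∞ τ₀)
        where
        column≡∞ : (B′ ⊗ᴹ C′) (inject₁ i) (fromℕ n) ≡ ∞
        column≡∞ = trans (sym (A′≡B′C′ (inject₁ i) (fromℕ n))) (extend-inject₁-fromℕ i)

      B : Matrix m k
      B i τ = B′ (inject₁ i) (punchIn τ₀ τ)

      C : Matrix k n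
      C τ j = C′ (punchIn τ₀ τ) (inject₁ j)

      A≡BC : ∀ i j → embed A i j ≡ (B ⊗ᴹ C) i j
      A≡BC i j = begin
        fin (A i j)                        ≡⟨ sym (extend-inject₁-inject₁ i j) ⟩
        extend A (inject₁ i) (inject₁ j)   ≡⟨ A′≡B′C′ (inject₁ i) (inject₁ j) ⟩
        (B′ ⊗ᴹ C′) (inject₁ i) (inject₁ j) ≡⟨ ⨁-drop-∞ k (term (inject₁ i) (inject₁ j)) τ₀
                                                (cong (_⊗ C′ τ₀ (inject₁ j)) (B′-τ₀≡∞ i)) ⟩
        (B ⊗ᴹ C) i j                       ∎
        where open ≡-Reasoning

  isFactorRank-suc : ∀ {m n m′ n′} {A : Matrix m n} {A′ : Matrix m′ n′} →
    (∀ {k} → FactorsThrough A k → FactorsThrough A′ (suc k)) →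
    (∀ {k} → FactorsThrough A′ (suc k) → FactorsThrough A k) →
    ¬ FactorsThrough A′ 0 →
    ∀ r → (IsFactorRank A r → IsFactorRank A′ (suc r)) × (IsFactorRank A′ (suc r) → IsFactorRank A r)
  isFactorRank-suc {A = A} {A′} up down ¬A′-0 r = forward , backward
    where
    forward : IsFactorRank A r → IsFactorRank A′ (suc r)
    forward (A-r , minimal) = up A-r , λ where
      zero    A′-0 → contradiction A′-0 ¬A′-0
      (suc k) A′-k → s≤s (minimal k (down A′-k))

    backward : IsFactorRank A′ (suc r) → IsFactorRank A r
    backward (A′-r , minimal) = down A′-r , λ k A-k → ≤-pred (minimal (suc k) (up A-k))

proposition2p6 : (ℝ : RealField) (m n : ℕ) (A : Fin m → Fin n → RealField.Carrier ℝ) (r : ℕ) →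
    (Tropical.IsFactorRank ℝ (Tropical.embed ℝ A) r → Tropical.IsFactorRank ℝ (Tropical.extend ℝ A) (suc r)) ×
    (Tropical.IsFactorRank ℝ (Tropical.extend ℝ A) (suc r) → Tropical.IsFactorRank ℝ (Tropical.embed ℝ A) r)
proposition2p6 ℝ m n A =
  isFactorRank-suc (extend-factorsThrough A) (embed-factorsThrough A) (¬extend-factorsThrough-0 A)
  where open TropicalFactorRank ℝ
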